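{- Let $\mu\subseteq\lambda$ be partitions and $T$ a standard Young tableau of shape $\lambda/\mu$. Then ${\rm sign}(T_0){\rm sign}(T_0\diamond T)$ does not depend on the choice of a standard Young tableau $T_0$ of shape $\mu$, and $${\rm sign}(T_0){\rm sign}(T_0\diamond T)=(-1)^{m}(-1)^{{\rm inv}(T)},\qquad m=\sum_{i\ge1}(\lambda_i-\mu_i)\sum_{j>i}\mu_j,$$ where ${\rm inv}(T)=\#\{(a,b): a,b\in\lambda/\mu,\ a\lhd b,\ T(a)>T(b)\}$.
   Context: Partitions are identified with Young diagrams (cell $(i,j)$: row $i$, column $j$); $\lambda/\mu$ is the set of cells of $\lambda$ not in $\mu$. A standard Young tableau (SYT) of shape $\lambda/\mu$ with $n$ cells is a bijection $T$ from its cells to $[n]$ with $T(i,j)\le T(i',j')$ whenever $i\le i',j\le j'$. Write $(i,j)\lhd(i',j')$ if $i<i'$ or ($i=i'$ and $j<j'$). For an SYT $S$ of straight shape, ${\rm sign}(S)=(-1)^{\#\{(a,b):a\lhd b,\,S(a)>S(b)\}}$. For $T_0$ an SYT of shape $\mu$ with $k$ cells and $T$ of shape $\lambda/\mu$, $T_0\diamond T$ is the SYT of shape $\lambda$ equal to $T_0$ on $\mu$ and to $T+k$ on $\lambda/\mu$. -}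

module Defs where

open import Data.Nat using (ℕ; zero; suc; _+_; _*_; _∸_; _≤_; _<_; _<ᵇ_; _≡ᵇ_)
open import Data.Bool using (Bool; true; false; _∧_; _∨_; if_then_else_)
open import Data.List using (List; []; _∷_; length; filterᵇ; concatMap; map; upTo; cartesianProduct)
open import Data.Nat.ListAction using (sum)
open import Data.List.Membership.Propositional using (_∈_)
open import Data.List.Relation.Unary.All using (All)
open import Data.List.Relation.Unary.Linked using (Linked)
open import Data.Product using (_×_; _,_; proj₁; proj₂; ∃-syntax)
open import Data.Integer using (ℤ; -1ℤ) renaming (_^_ to _^ℤ_)
open import Relation.Binary.PropositionalEquality using (_≡_)

-- A partition: weakly decreasing list of positive parts (la₁ ≥ la₂ ≥ … > 0).
-- Rows and columns are indexed from 0.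
IsPartition : List ℕ → Set
IsPartition p = Linked (λ a b → b ≤ a) p × All (λ a → 0 < a) p

part : List ℕ → ℕ → ℕ
part []       _       = 0
part (x ∷ _)  zero    = x
part (_ ∷ xs) (suc i) = part xs i

_⊆ₚ_ : List ℕ → List ℕ → Set
mu ⊆ₚ la = ∀ i → part mu i ≤ part la i

Cell : Set
Cell = ℕ × ℕ   -- (row i, column j)

cells : List ℕ → List Cell
cells la = concatMap (λ i → map (λ j → (i , j)) (upTo (part la i))) (upTo (length la))

inDiagramᵇ : List ℕ → Cell → Bool
inDiagramᵇ mu (i , j) = j <ᵇ part mu i

notᵇ : Bool → Bool
notᵇ true = false
notᵇ false = true

skewCells : List ℕ → List ℕ → List Cell
skewCells la mu = filterᵇ (λ c → notᵇ (inDiagramᵇ mu c)) (cells la)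

-- A standard Young tableau of shape la/mu: T restricted to the cells of la/mu
-- is a bijection onto [n] = {1,…,n}, n = #cells, and weakly increasing in
-- the product order on cells.  (Values of T off the shape are irrelevant.)
record IsSYT (la mu : List ℕ) (T : Cell → ℕ) : Set where
  field
    range : ∀ c → c ∈ skewCells la mu → 1 ≤ T c × T c ≤ length (skewCells la mu)
    inj   : ∀ a b → a ∈ skewCells la mu → b ∈ skewCells la mu → T a ≡ T b → a ≡ b
    surj  : ∀ k → 1 ≤ k → k ≤ length (skewCells la mu) →
            ∃[ c ] (c ∈ skewCells la mu × T c ≡ k)
    mono  : ∀ a b → a ∈ skewCells la mu → b ∈ skewCells la mu →
            proj₁ a ≤ proj₁ b → proj₂ a ≤ proj₂ b → T a ≤ T b

_◁ᵇ_ : Cell → Cell → Bool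
(i , j) ◁ᵇ (i' , j') = (i <ᵇ i') ∨ ((i ≡ᵇ i') ∧ (j <ᵇ j'))

inv : List ℕ → List ℕ → (Cell → ℕ) → ℕ
inv la mu T = length (filterᵇ (λ ab → (proj₁ ab ◁ᵇ proj₂ ab) ∧ (T (proj₂ ab) <ᵇ T (proj₁ ab)))
                            (cartesianProduct (skewCells la mu) (skewCells la mu)))

sgnPow : ℕ → ℤ
sgnPow k = -1ℤ ^ℤ k

sign : List ℕ → (Cell → ℕ) → ℤ
sign la S = sgnPow (inv la [] S)

_⋄⟨_⟩_ : (Cell → ℕ) → List ℕ → (Cell → ℕ) → (Cell → ℕ)
(T₀ ⋄⟨ mu ⟩ T) c = if inDiagramᵇ mu c then T₀ c else T c + length (cells mu)

-- m = Σ_{i≥1} (la_i − mu_i) Σ_{j>i} mu_j   (rows beyond length la contribute 0)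
tailSum : List ℕ → ℕ → ℕ
tailSum mu i = sum (map (λ j → part mu j) (filterᵇ (λ j → i <ᵇ j) (upTo (length mu))))

mExp : List ℕ → List ℕ → ℕ
mExp la mu = sum (map (λ i → (part la i ∸ part mu i) * tailSum mu i) (upTo (length la)))

module Submission where

-- Let V = T₀ ⋄ T, a filling of the cells C of λ.  Write M for the cells of
-- μ and S for the cells of λ/μ.  Counting the inversions of V pair by pair
-- over C × C and splitting both coordinates according to M / S gives four
-- blocks (the block decomposition ∑-blocks):
--   * M × M : V agrees with T₀ there, so this block is inv(T₀);
--   * S × S : V = T + |μ| there, so this block is inv(T);
--   * M × S : never an inversion, since V ≤ |μ| on M and V > |μ| on S;
--   * S × M : an inversion exactly when a ◁ b, independently of T₀ and T.
-- The last block is a count depending on the shape only; summing it row by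
-- row gives  ∑ᵢ (λᵢ − μᵢ) · ∑_{j>i} μⱼ = m  (crossings≡mExp).  Hence
--   inv(T₀ ⋄ T) = inv(T₀) + (m + inv(T)),
-- and since (-1)^(2·inv T₀) = 1 the product of signs is (-1)^(m + inv T),
-- which in particular does not depend on T₀.

open import Defs
open import Data.Nat using (ℕ)
open import Data.List using (List; [])
open import Data.Product using (_×_)
open import Data.Integer using (ℤ; _*_)
open import Relation.Binary.PropositionalEquality using (_≡_)

open import Data.Nat using (zero; suc; _+_; _∸_; _≤_; _<_; _<ᵇ_; _≡ᵇ_; z≤n; s≤s; _≤?_)
import Data.Nat as ℕ
import Data.Nat.Properties as ℕₚ
open import Data.Nat.ListAction using (sum)
open import Data.Nat.ListAction.Properties using (sum-++)
open import Data.Bool using (Bool; true; false; _∧_; _∨_; if_then_else_; T?) renaming (T to IsTrue)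
open import Data.Bool.Properties using (∧-zeroʳ; ∧-identityʳ)
open import Data.List using (_∷_; _++_; map; length; filterᵇ; concatMap; upTo; cartesianProduct; [_])
import Data.List.Properties as Listₚ
open import Data.List.Membership.Propositional using (_∈_)
open import Data.List.Membership.Propositional.Properties using (∈-filter⁻; ∈-upTo⁻)
open import Data.List.Relation.Unary.Any using (here; there)
open import Data.List.Relation.Unary.All using (All; _∷_; universal)
open import Data.Product using (_,_; proj₁; proj₂)
open import Data.Sum using (_⊎_; inj₁; inj₂)
open import Data.Empty using (⊥-elim)
open import Relation.Nullary using (Dec; yes; no)
open import Relation.Binary.PropositionalEquality using (refl; sym; trans; cong; cong₂; subst; module ≡-Reasoning)
import Data.Integer as ℤ
import Data.Integer.Properties as ℤₚ
open import Algebra.Properties.CommutativeSemigroup ℕₚ.+-commutativeSemigroup using (interchange)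

∑ : {A : Set} → List A → (A → ℕ) → ℕ
∑ L g = sum (map g L)

χ : Bool → ℕ
χ b = if b then 1 else 0

module _ {A : Set} where

  ∑-++ : (xs ys : List A) (g : A → ℕ) → ∑ (xs ++ ys) g ≡ ∑ xs g + ∑ ys g
  ∑-++ xs ys g = trans (cong sum (Listₚ.map-++ g xs ys)) (sum-++ (map g xs) (map g ys))

  ∑-cong∈ : (L : List A) {g h : A → ℕ} → (∀ x → x ∈ L → g x ≡ h x) → ∑ L g ≡ ∑ L h
  ∑-cong∈ []       e = refl
  ∑-cong∈ (x ∷ xs) e = cong₂ _+_ (e x (here refl)) (∑-cong∈ xs (λ y m → e y (there m)))

  ∑-cong : (L : List A) {g h : A → ℕ} → (∀ x → g x ≡ h x) → ∑ L g ≡ ∑ L h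
  ∑-cong L e = ∑-cong∈ L (λ x _ → e x)

  ∑-vanish : (L : List A) {g : A → ℕ} → (∀ x → x ∈ L → g x ≡ 0) → ∑ L g ≡ 0
  ∑-vanish []       e = refl
  ∑-vanish (x ∷ xs) e = cong₂ _+_ (e x (here refl)) (∑-vanish xs (λ y m → e y (there m)))

  ∑-const : (L : List A) (c : ℕ) → ∑ L (λ _ → c) ≡ length L ℕ.* c
  ∑-const []       c = refl
  ∑-const (x ∷ xs) c = cong (c +_) (∑-const xs c)

  ∑-ones : (L : List A) → ∑ L (λ _ → 1) ≡ length L
  ∑-ones L = trans (∑-const L 1) (ℕₚ.*-identityʳ _)

  ∑-+ : (L : List A) (f g : A → ℕ) → ∑ L (λ x → f x + g x) ≡ ∑ L f + ∑ L g
  ∑-+ []       f g = refl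
  ∑-+ (x ∷ xs) f g = trans (cong (f x + g x +_) (∑-+ xs f g)) (interchange (f x) (g x) (∑ xs f) (∑ xs g))

  ∑-filter : (p : A → Bool) (L : List A) (g : A → ℕ) →
             ∑ (filterᵇ p L) g ≡ ∑ L (λ x → if p x then g x else 0)
  ∑-filter p []       g = refl
  ∑-filter p (x ∷ xs) g with p x
  ... | true  = cong (g x +_) (∑-filter p xs g)
  ... | false = ∑-filter p xs g

  length-filterᵇ : (p : A → Bool) (L : List A) → length (filterᵇ p L) ≡ ∑ L (λ x → χ (p x))
  length-filterᵇ p L = trans (sym (∑-ones (filterᵇ p L))) (∑-filter p L (λ _ → 1))

  ∑-split : (p : A → Bool) (L : List A) (g : A → ℕ) →
            ∑ L g ≡ ∑ (filterᵇ p L) g + ∑ (filterᵇ (λ x → notᵇ (p x)) L) g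
  ∑-split p L g = begin
    ∑ L g
      ≡⟨ ∑-cong L (λ x → cut (p x) (g x)) ⟩
    ∑ L (λ x → (if p x then g x else 0) + (if notᵇ (p x) then g x else 0))
      ≡⟨ ∑-+ L _ _ ⟩
    ∑ L (λ x → if p x then g x else 0) + ∑ L (λ x → if notᵇ (p x) then g x else 0)
      ≡⟨ sym (cong₂ _+_ (∑-filter p L g) (∑-filter (λ x → notᵇ (p x)) L g)) ⟩
    ∑ (filterᵇ p L) g + ∑ (filterᵇ (λ x → notᵇ (p x)) L) g ∎
    where
    open ≡-Reasoning
    cut : ∀ b n → n ≡ (if b then n else 0) + (if notᵇ b then n else 0)
    cut true  n = sym (ℕₚ.+-identityʳ n)
    cut false n = refl

  ∑-blocks : (p : A → Bool) (L : List A) (F : A → A → ℕ) →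
    let In  = filterᵇ p L
        Out = filterᵇ (λ x → notᵇ (p x)) L in
    ∑ L (λ a → ∑ L (F a)) ≡
      (∑ In (λ a → ∑ In (F a)) + ∑ In (λ a → ∑ Out (F a)))
      + (∑ Out (λ a → ∑ In (F a)) + ∑ Out (λ a → ∑ Out (F a)))
  ∑-blocks p L F =
    trans (∑-cong L (λ a → ∑-split p L (F a)))
          (trans (∑-split p L _)
                 (cong₂ _+_ (∑-+ (filterᵇ p L) _ _) (∑-+ (filterᵇ (λ x → notᵇ (p x)) L) _ _)))

∑-map : {A B : Set} (f : A → B) (L : List A) (g : B → ℕ) → ∑ (map f L) g ≡ ∑ L (λ x → g (f x))
∑-map f L g = cong sum (sym (Listₚ.map-∘ L))

module _ {A B : Set} where

  ∑-concatMap : (f : A → List B) (L : List A) (g : B → ℕ) →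
                ∑ (concatMap f L) g ≡ ∑ L (λ x → ∑ (f x) g)
  ∑-concatMap f []       g = refl
  ∑-concatMap f (x ∷ xs) g = trans (∑-++ (f x) (concatMap f xs) g) (cong (∑ (f x) g +_) (∑-concatMap f xs g))

  ∑-cartesian : (xs : List A) (ys : List B) (g : A × B → ℕ) →
                ∑ (cartesianProduct xs ys) g ≡ ∑ xs (λ a → ∑ ys (λ b → g (a , b)))
  ∑-cartesian []       ys g = refl
  ∑-cartesian (x ∷ xs) ys g =
    trans (∑-++ (map (x ,_) ys) _ g) (cong₂ _+_ (∑-map (x ,_) ys g) (∑-cartesian xs ys g))

  filterᵇ-map : (p : B → Bool) (f : A → B) (L : List A) →
                filterᵇ p (map f L) ≡ map f (filterᵇ (λ x → p (f x)) L)
  filterᵇ-map p f []       = refl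
  filterᵇ-map p f (x ∷ xs) with p (f x)
  ... | true  = cong (f x ∷_) (filterᵇ-map p f xs)
  ... | false = filterᵇ-map p f xs

  filterᵇ-concatMap : (p : B → Bool) (f : A → List B) (L : List A) →
                      filterᵇ p (concatMap f L) ≡ concatMap (λ x → filterᵇ p (f x)) L
  filterᵇ-concatMap p f []       = refl
  filterᵇ-concatMap p f (x ∷ xs) =
    trans (Listₚ.filter-++ (λ y → T? (p y)) (f x) (concatMap f xs))
          (cong (filterᵇ p (f x) ++_) (filterᵇ-concatMap p f xs))

<ᵇ-true : ∀ {m n} → m < n → (m <ᵇ n) ≡ true
<ᵇ-true {m} {n} m<n with m <ᵇ n | ℕₚ.<⇒<ᵇ m<n
... | true | _ = refl

<ᵇ-false : ∀ {m n} → n ≤ m → (m <ᵇ n) ≡ false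
<ᵇ-false {m} {n} n≤m with m <ᵇ n in eq
... | false = refl
... | true  = ⊥-elim (ℕₚ.<⇒≱ (ℕₚ.<ᵇ⇒< m n (subst IsTrue (sym eq) _)) n≤m)

<ᵇ-false⇒≥ : ∀ {m n} → (m <ᵇ n) ≡ false → n ≤ m
<ᵇ-false⇒≥ {m} {n} eq = ℕₚ.≮⇒≥ (λ m<n → true≢false (trans (sym (<ᵇ-true m<n)) eq))
  where
  true≢false : true ≡ false → _
  true≢false ()

+-cancelˡ-<ᵇ : ∀ k m n → (k + m <ᵇ k + n) ≡ (m <ᵇ n)
+-cancelˡ-<ᵇ zero    m n = refl
+-cancelˡ-<ᵇ (suc k) m n = +-cancelˡ-<ᵇ k m n

notᵇ-true : ∀ b → IsTrue (notᵇ b) → b ≡ false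
notᵇ-true false _ = refl

upTo-suc : ∀ n → upTo (suc n) ≡ upTo n ++ [ n ]
upTo-suc n = sym (Listₚ.upTo-∷ʳ n)

filter-upTo-below : ∀ m n → filterᵇ (λ j → j <ᵇ m) (upTo n) ≡ upTo (n ℕ.⊓ m)
filter-upTo-below m zero    = refl
filter-upTo-below m (suc n) = begin
  filterᵇ (_<ᵇ m) (upTo (suc n))
    ≡⟨ cong (filterᵇ (_<ᵇ m)) (upTo-suc n) ⟩
  filterᵇ (_<ᵇ m) (upTo n ++ [ n ])
    ≡⟨ Listₚ.filter-++ (λ j → T? (j <ᵇ m)) (upTo n) [ n ] ⟩
  filterᵇ (_<ᵇ m) (upTo n) ++ filterᵇ (_<ᵇ m) [ n ]
    ≡⟨ cong (_++ filterᵇ (_<ᵇ m) [ n ]) (filter-upTo-below m n) ⟩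
  upTo (n ℕ.⊓ m) ++ filterᵇ (_<ᵇ m) [ n ]
    ≡⟨ last-step (n ℕₚ.<? m) ⟩
  upTo (suc n ℕ.⊓ m) ∎
  where
  open ≡-Reasoning
  last-step : Dec (n < m) → upTo (n ℕ.⊓ m) ++ filterᵇ (_<ᵇ m) [ n ] ≡ upTo (suc n ℕ.⊓ m)
  last-step (yes n<m) rewrite <ᵇ-true n<m | ℕₚ.m≤n⇒m⊓n≡m (ℕₚ.<⇒≤ n<m) | ℕₚ.m≤n⇒m⊓n≡m n<m = sym (upTo-suc n)
  last-step (no n≮m) rewrite <ᵇ-false (ℕₚ.≮⇒≥ n≮m) | ℕₚ.m≥n⇒m⊓n≡n (ℕₚ.≮⇒≥ n≮m)
                           | ℕₚ.m≥n⇒m⊓n≡n (ℕₚ.≤-trans (ℕₚ.≮⇒≥ n≮m) (ℕₚ.n≤1+n n)) = Listₚ.++-identityʳ _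

count-upTo-above : ∀ m n → length (filterᵇ (λ j → notᵇ (j <ᵇ m)) (upTo n)) ≡ n ∸ m
count-upTo-above m n = ℕₚ.+-cancelˡ-≡ (m ℕ.⊓ n) (length above) (n ∸ m) (begin
  m ℕ.⊓ n + length above      ≡⟨ cong (_+ length above) (sym size-below) ⟩
  length below + length above ≡⟨ sym total ⟩
  n                           ≡⟨ sym (ℕₚ.m⊓n+n∸m≡n m n) ⟩
  m ℕ.⊓ n + (n ∸ m) ∎)
  where
  open ≡-Reasoning
  below = filterᵇ (_<ᵇ m) (upTo n)
  above = filterᵇ (λ j → notᵇ (j <ᵇ m)) (upTo n)
  size-below : length below ≡ m ℕ.⊓ n
  size-below = trans (cong length (filter-upTo-below m n))
                     (trans (Listₚ.length-upTo _) (ℕₚ.⊓-comm n m))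
  total : n ≡ length below + length above
  total = begin
    n                                  ≡⟨ sym (Listₚ.length-upTo n) ⟩
    length (upTo n)                    ≡⟨ sym (∑-ones (upTo n)) ⟩
    ∑ (upTo n) (λ _ → 1)               ≡⟨ ∑-split (_<ᵇ m) (upTo n) (λ _ → 1) ⟩
    ∑ below (λ _ → 1) + ∑ above (λ _ → 1) ≡⟨ cong₂ _+_ (∑-ones below) (∑-ones above) ⟩
    length below + length above ∎

concatMap-upTo-trunc : ∀ {B : Set} (f : ℕ → List B) m n → m ≤ n → (∀ i → m ≤ i → f i ≡ []) →
                       concatMap f (upTo n) ≡ concatMap f (upTo m)
concatMap-upTo-trunc f m zero    z≤n  vanish = refl
concatMap-upTo-trunc f m (suc n) m≤1+n vanish with ℕₚ.m≤n⇒m<n∨m≡n m≤1+n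
... | inj₂ refl = refl
... | inj₁ m<1+n = begin
  concatMap f (upTo (suc n))          ≡⟨ cong (concatMap f) (upTo-suc n) ⟩
  concatMap f (upTo n ++ [ n ])       ≡⟨ Listₚ.concatMap-++ f (upTo n) [ n ] ⟩
  concatMap f (upTo n) ++ (f n ++ []) ≡⟨ cong (λ z → concatMap f (upTo n) ++ (z ++ [])) (vanish n m≤n) ⟩
  concatMap f (upTo n) ++ []          ≡⟨ Listₚ.++-identityʳ _ ⟩
  concatMap f (upTo n)                ≡⟨ concatMap-upTo-trunc f m n m≤n vanish ⟩
  concatMap f (upTo m) ∎
  where
  open ≡-Reasoning
  m≤n = ℕₚ.≤-pred m<1+n

part-beyond : ∀ (mu : List ℕ) i → length mu ≤ i → part mu i ≡ 0
part-beyond []       i       _       = refl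
part-beyond (x ∷ xs) (suc i) (s≤s l) = part-beyond xs i l

part-pos : ∀ (mu : List ℕ) i → All (λ a → 0 < a) mu → i < length mu → 0 < part mu i
part-pos (x ∷ xs) zero    (px ∷ _)  _       = px
part-pos (x ∷ xs) (suc i) (_ ∷ pxs) (s≤s l) = part-pos xs i pxs l

length-⊆ₚ : ∀ (la mu : List ℕ) → All (λ a → 0 < a) mu → mu ⊆ₚ la → length mu ≤ length la
length-⊆ₚ la mu pos sub with length mu ≤? length la
... | yes le = le
... | no  gt = ⊥-elim (ℕₚ.<⇒≱ (ℕₚ.<-≤-trans (part-pos mu (length la) pos (ℕₚ.≰⇒> gt)) (sub (length la)))
                              (ℕₚ.≤-reflexive (part-beyond la (length la) ℕₚ.≤-refl)))

rowCells : List ℕ → ℕ → List Cell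
rowCells mu i = map (λ j → (i , j)) (upTo (part mu i))

skewCells-[] : ∀ la → skewCells la [] ≡ cells la
skewCells-[] la = Listₚ.filter-all (λ c → T? (notᵇ (inDiagramᵇ [] c))) (universal _ _)

inside-μ : ∀ mu {L c} → c ∈ filterᵇ (inDiagramᵇ mu) L → inDiagramᵇ mu c ≡ true
inside-μ mu {L} {c} m with inDiagramᵇ mu c | proj₂ (∈-filter⁻ (λ c → T? (inDiagramᵇ mu c)) {xs = L} m)
... | true | _ = refl

outside-μ : ∀ la mu {c} → c ∈ skewCells la mu → inDiagramᵇ mu c ≡ false
outside-μ la mu m = notᵇ-true _ (proj₂ (∈-filter⁻ (λ c → T? (notᵇ (inDiagramᵇ mu c))) {xs = cells la} m))

cells-inside : ∀ la mu → IsPartition mu → mu ⊆ₚ la → filterᵇ (inDiagramᵇ mu) (cells la) ≡ cells mu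
cells-inside la mu pmu sub = begin
  filterᵇ (inDiagramᵇ mu) (cells la)
    ≡⟨ filterᵇ-concatMap (inDiagramᵇ mu) _ rows ⟩
  concatMap (λ i → filterᵇ (inDiagramᵇ mu) (map (λ j → (i , j)) (upTo (part la i)))) rows
    ≡⟨ Listₚ.concatMap-cong (λ i → filterᵇ-map (inDiagramᵇ mu) (λ j → (i , j)) (upTo (part la i))) rows ⟩
  concatMap (λ i → map (λ j → (i , j)) (filterᵇ (_<ᵇ part mu i) (upTo (part la i)))) rows
    ≡⟨ Listₚ.concatMap-cong (λ i → cong (map (λ j → (i , j))) (row-inside i)) rows ⟩
  concatMap (rowCells mu) rows
    ≡⟨ concatMap-upTo-trunc (rowCells mu) (length mu) (length la) (length-⊆ₚ la mu (proj₂ pmu) sub)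
         (λ i le → cong (λ n → map (λ j → (i , j)) (upTo n)) (part-beyond mu i le)) ⟩
  cells mu ∎
  where
  open ≡-Reasoning
  rows = upTo (length la)
  row-inside : ∀ i → filterᵇ (_<ᵇ part mu i) (upTo (part la i)) ≡ upTo (part mu i)
  row-inside i = trans (filter-upTo-below (part mu i) (part la i)) (cong upTo (ℕₚ.m≥n⇒m⊓n≡n (sub i)))

-- The shape count of the block S × M: pairs (a, b) with a ∈ λ/μ, b ∈ μ, a ◁ b.
crossings : List ℕ → List ℕ → ℕ
crossings la mu = ∑ (skewCells la mu) (λ a → ∑ (cells mu) (λ b → χ (a ◁ᵇ b)))

followers-in-row : ∀ mu i j → part mu i ≤ j → ∀ i' →
  ∑ (upTo (part mu i')) (λ j' → χ ((i <ᵇ i') ∨ ((i ≡ᵇ i') ∧ (j <ᵇ j'))))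
    ≡ (if i <ᵇ i' then part mu i' else 0)
followers-in-row mu i j le i' with i <ᵇ i'
... | true  = trans (∑-ones (upTo (part mu i'))) (Listₚ.length-upTo (part mu i'))
... | false with i ≡ᵇ i' in eq
...   | false = ∑-vanish (upTo (part mu i')) (λ _ _ → refl)
...   | true  = ∑-vanish (upTo (part mu i')) (λ j' m → cong χ (<ᵇ-false (ℕₚ.<⇒≤ (ℕₚ.<-≤-trans (∈-upTo⁻ m) μi'≤j))))
  where
  μi'≤j : part mu i' ≤ j
  μi'≤j = subst (λ r → part mu r ≤ j) (ℕₚ.≡ᵇ⇒≡ i i' (subst IsTrue (sym eq) _)) le

followers-in-μ : ∀ mu i j → part mu i ≤ j → ∑ (cells mu) (λ b → χ ((i , j) ◁ᵇ b)) ≡ tailSum mu i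
followers-in-μ mu i j le = begin
  ∑ (cells mu) (λ b → χ ((i , j) ◁ᵇ b))
    ≡⟨ ∑-concatMap (rowCells mu) (upTo (length mu)) _ ⟩
  ∑ (upTo (length mu)) (λ i' → ∑ (rowCells mu i') (λ b → χ ((i , j) ◁ᵇ b)))
    ≡⟨ ∑-cong (upTo (length mu)) (λ i' → trans (∑-map _ (upTo (part mu i')) _) (followers-in-row mu i j le i')) ⟩
  ∑ (upTo (length mu)) (λ i' → if i <ᵇ i' then part mu i' else 0)
    ≡⟨ sym (∑-filter (i <ᵇ_) (upTo (length mu)) (part mu)) ⟩
  tailSum mu i ∎
  where open ≡-Reasoning

-- Summing ∑_{i' > i} μ_{i'} over the λᵢ − μᵢ cells of each row i of λ/μ gives m.
crossings≡mExp : ∀ la mu → IsPartition mu → mu ⊆ₚ la → crossings la mu ≡ mExp la mu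
crossings≡mExp la mu pmu sub = begin
  crossings la mu
    ≡⟨ ∑-cong∈ (skewCells la mu) (λ { (i , j) m → followers-in-μ mu i j (<ᵇ-false⇒≥ (outside-μ la mu m)) }) ⟩
  ∑ (skewCells la mu) (λ a → tailSum mu (proj₁ a))
    ≡⟨ ∑-filter (λ c → notᵇ (inDiagramᵇ mu c)) (cells la) _ ⟩
  ∑ (cells la) (λ c → if notᵇ (inDiagramᵇ mu c) then tailSum mu (proj₁ c) else 0)
    ≡⟨ ∑-concatMap _ (upTo (length la)) _ ⟩
  _ ≡⟨ ∑-cong (upTo (length la)) (λ i → trans (∑-map _ (upTo (part la i)) _) (row-count i)) ⟩
  mExp la mu ∎
  where
  open ≡-Reasoning
  row-count : ∀ i → ∑ (upTo (part la i)) (λ j → if notᵇ (j <ᵇ part mu i) then tailSum mu i else 0)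
                    ≡ (part la i ∸ part mu i) ℕ.* tailSum mu i
  row-count i = begin
    _ ≡⟨ sym (∑-filter (λ j → notᵇ (j <ᵇ part mu i)) (upTo (part la i)) (λ _ → tailSum mu i)) ⟩
    _ ≡⟨ ∑-const (filterᵇ (λ j → notᵇ (j <ᵇ part mu i)) (upTo (part la i))) (tailSum mu i) ⟩
    _ ≡⟨ cong (ℕ._* tailSum mu i) (count-upTo-above (part mu i) (part la i)) ⟩
    (part la i ∸ part mu i) ℕ.* tailSum mu i ∎

isInversion : (Cell → ℕ) → Cell → Cell → Bool
isInversion W a b = (a ◁ᵇ b) ∧ (W b <ᵇ W a)

inv-as-sum : ∀ la mu W → inv la mu W ≡ ∑ (skewCells la mu) (λ a → ∑ (skewCells la mu) (λ b → χ (isInversion W a b)))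
inv-as-sum la mu W =
  trans (length-filterᵇ _ (cartesianProduct (skewCells la mu) (skewCells la mu)))
        (∑-cartesian (skewCells la mu) (skewCells la mu) (λ ab → χ (isInversion W (proj₁ ab) (proj₂ ab))))

-- The inversion indicator of V = T₀ ⋄ T on the four blocks.  Only the
-- ranges of the tableaux matter: T₀ ≤ |μ| on μ and T ≥ 1 on λ/μ.
module Concatenation (mu : List ℕ) (T₀ T : Cell → ℕ) where

  k : ℕ
  k = length (cells mu)

  V : Cell → ℕ
  V = T₀ ⋄⟨ mu ⟩ T

  V-inside : ∀ a → inDiagramᵇ mu a ≡ true → V a ≡ T₀ a
  V-inside a e = cong (λ b → if b then T₀ a else T a + k) e

  V-outside : ∀ a → inDiagramᵇ mu a ≡ false → V a ≡ T a + k
  V-outside a e = cong (λ b → if b then T₀ a else T a + k) e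

  inversion-inside : ∀ a b → inDiagramᵇ mu a ≡ true → inDiagramᵇ mu b ≡ true →
                     isInversion V a b ≡ isInversion T₀ a b
  inversion-inside a b ea eb = cong₂ (λ x y → (a ◁ᵇ b) ∧ (y <ᵇ x)) (V-inside a ea) (V-inside b eb)

  inversion-outside : ∀ a b → inDiagramᵇ mu a ≡ false → inDiagramᵇ mu b ≡ false →
                      isInversion V a b ≡ isInversion T a b
  inversion-outside a b ea eb = begin
    (a ◁ᵇ b) ∧ (V b <ᵇ V a)         ≡⟨ cong₂ (λ x y → (a ◁ᵇ b) ∧ (y <ᵇ x)) (V-outside a ea) (V-outside b eb) ⟩
    (a ◁ᵇ b) ∧ (T b + k <ᵇ T a + k) ≡⟨ cong (λ z → (a ◁ᵇ b) ∧ z) shift ⟩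
    (a ◁ᵇ b) ∧ (T b <ᵇ T a) ∎
    where
    open ≡-Reasoning
    shift : (T b + k <ᵇ T a + k) ≡ (T b <ᵇ T a)
    shift rewrite ℕₚ.+-comm (T b) k | ℕₚ.+-comm (T a) k = +-cancelˡ-<ᵇ k (T b) (T a)

  -- A pair (cell of μ, cell of λ/μ) is never an inversion, as V is smaller on μ …
  inversion-inside-outside : ∀ a b → inDiagramᵇ mu a ≡ true → inDiagramᵇ mu b ≡ false →
                             T₀ a ≤ k → 1 ≤ T b → isInversion V a b ≡ false
  inversion-inside-outside a b ea eb Ta≤k 1≤Tb =
    trans (cong (λ z → (a ◁ᵇ b) ∧ z) (<ᵇ-false (Va≤Vb (V-inside a ea) (V-outside b eb))))
          (∧-zeroʳ (a ◁ᵇ b))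
    where
    Va≤Vb : V a ≡ T₀ a → V b ≡ T b + k → V a ≤ V b
    Va≤Vb e₁ e₂ rewrite e₁ | e₂ = ℕₚ.≤-trans Ta≤k (ℕₚ.≤-trans (ℕₚ.n≤1+n k) (ℕₚ.+-monoˡ-≤ k 1≤Tb))

  -- … so a pair (cell of λ/μ, cell of μ) is an inversion exactly when a ◁ b.
  inversion-outside-inside : ∀ a b → inDiagramᵇ mu a ≡ false → inDiagramᵇ mu b ≡ true →
                             T₀ b ≤ k → 1 ≤ T a → isInversion V a b ≡ (a ◁ᵇ b)
  inversion-outside-inside a b ea eb Tb≤k 1≤Ta =
    trans (cong (λ z → (a ◁ᵇ b) ∧ z) (<ᵇ-true (Vb<Va (V-inside b eb) (V-outside a ea))))
          (∧-identityʳ (a ◁ᵇ b))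
    where
    Vb<Va : V b ≡ T₀ b → V a ≡ T a + k → V b < V a
    Vb<Va e₁ e₂ rewrite e₁ | e₂ = ℕₚ.≤-<-trans Tb≤k (ℕₚ.+-monoˡ-≤ k 1≤Ta)

inv-concatenation : ∀ la mu → IsPartition mu → mu ⊆ₚ la → (T₀ T : Cell → ℕ) →
  IsSYT mu [] T₀ → IsSYT la mu T →
  inv la [] (T₀ ⋄⟨ mu ⟩ T) ≡ inv mu [] T₀ + (crossings la mu + inv la mu T)
inv-concatenation la mu pmu sub T₀ T syt₀ syt = begin
  inv la [] V
    ≡⟨ inv-as-sum la [] V ⟩
  ∑ (skewCells la []) (λ a → ∑ (skewCells la []) (F a))
    ≡⟨ cong (λ L → ∑ L (λ a → ∑ L (F a))) (skewCells-[] la) ⟩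
  ∑ (cells la) (λ a → ∑ (cells la) (F a))
    ≡⟨ ∑-blocks (inDiagramᵇ mu) (cells la) F ⟩
  (∑ M (λ a → ∑ M (F a)) + ∑ M (λ a → ∑ S (F a))) + (∑ S (λ a → ∑ M (F a)) + ∑ S (λ a → ∑ S (F a)))
    ≡⟨ cong₂ _+_ (trans (cong₂ _+_ block-MM block-MS) (ℕₚ.+-identityʳ _)) (cong₂ _+_ block-SM block-SS) ⟩
  inv mu [] T₀ + (crossings la mu + inv la mu T) ∎
  where
  open ≡-Reasoning
  open Concatenation mu T₀ T
  M = filterᵇ (inDiagramᵇ mu) (cells la)
  S = skewCells la mu
  F : Cell → Cell → ℕ
  F a b = χ (isInversion V a b)

  M≡ : M ≡ cells mu
  M≡ = cells-inside la mu pmu sub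
  inM : ∀ {a} → a ∈ M → inDiagramᵇ mu a ≡ true
  inM = inside-μ mu {cells la}
  inS : ∀ {a} → a ∈ S → inDiagramᵇ mu a ≡ false
  inS = outside-μ la mu
  T₀≤k : ∀ {a} → a ∈ M → T₀ a ≤ k
  T₀≤k {a} m = subst (T₀ a ≤_) (cong length (skewCells-[] mu))
                 (proj₂ (IsSYT.range syt₀ a (subst (a ∈_) (trans M≡ (sym (skewCells-[] mu))) m)))
  1≤T : ∀ {a} → a ∈ S → 1 ≤ T a
  1≤T {a} m = proj₁ (IsSYT.range syt a m)

  block-MM : ∑ M (λ a → ∑ M (F a)) ≡ inv mu [] T₀
  block-MM = begin
    ∑ M (λ a → ∑ M (F a))
      ≡⟨ ∑-cong∈ M (λ a ma → ∑-cong∈ M (λ b mb → cong χ (inversion-inside a b (inM ma) (inM mb)))) ⟩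
    ∑ M (λ a → ∑ M (λ b → χ (isInversion T₀ a b)))
      ≡⟨ cong (λ L → ∑ L (λ a → ∑ L (λ b → χ (isInversion T₀ a b)))) (trans M≡ (sym (skewCells-[] mu))) ⟩
    ∑ (skewCells mu []) (λ a → ∑ (skewCells mu []) (λ b → χ (isInversion T₀ a b)))
      ≡⟨ sym (inv-as-sum mu [] T₀) ⟩
    inv mu [] T₀ ∎

  block-MS : ∑ M (λ a → ∑ S (F a)) ≡ 0
  block-MS = ∑-vanish M (λ a ma → ∑-vanish S (λ b mb →
               cong χ (inversion-inside-outside a b (inM ma) (inS mb) (T₀≤k ma) (1≤T mb))))

  block-SM : ∑ S (λ a → ∑ M (F a)) ≡ crossings la mu
  block-SM = trans (∑-cong∈ S (λ a ma → ∑-cong∈ M (λ b mb →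
                      cong χ (inversion-outside-inside a b (inS ma) (inM mb) (T₀≤k mb) (1≤T ma)))))
                   (cong (λ L → ∑ S (λ a → ∑ L (λ b → χ (a ◁ᵇ b)))) M≡)

  block-SS : ∑ S (λ a → ∑ S (F a)) ≡ inv la mu T
  block-SS = trans (∑-cong∈ S (λ a ma → ∑-cong∈ S (λ b mb → cong χ (inversion-outside a b (inS ma) (inS mb)))))
                   (sym (inv-as-sum la mu T))

sgnPow-±1 : ∀ a → sgnPow a ≡ ℤ.1ℤ ⊎ sgnPow a ≡ ℤ.-1ℤ
sgnPow-±1 zero    = inj₁ refl
sgnPow-±1 (suc a) with sgnPow-±1 a
... | inj₁ e rewrite e = inj₂ refl
... | inj₂ e rewrite e = inj₁ refl

sgnPow-square : ∀ a → sgnPow a * sgnPow a ≡ ℤ.1ℤ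
sgnPow-square a with sgnPow-±1 a
... | inj₁ e rewrite e = refl
... | inj₂ e rewrite e = refl

sgnPow-cancel : ∀ a b c → sgnPow a * sgnPow (a + (b + c)) ≡ sgnPow b * sgnPow c
sgnPow-cancel a b c = begin
  sgnPow a * sgnPow (a + (b + c))        ≡⟨ cong (sgnPow a *_) (ℤₚ.^-distribˡ-+-* ℤ.-1ℤ a (b + c)) ⟩
  sgnPow a * (sgnPow a * sgnPow (b + c)) ≡⟨ sym (ℤₚ.*-assoc (sgnPow a) _ _) ⟩
  (sgnPow a * sgnPow a) * sgnPow (b + c) ≡⟨ cong (_* sgnPow (b + c)) (sgnPow-square a) ⟩
  ℤ.1ℤ * sgnPow (b + c)                  ≡⟨ ℤₚ.*-identityˡ _ ⟩
  sgnPow (b + c)                         ≡⟨ ℤₚ.^-distribˡ-+-* ℤ.-1ℤ b c ⟩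
  sgnPow b * sgnPow c ∎
  where open ≡-Reasoning

proposition4p1 : (la mu : List ℕ) → IsPartition la → IsPartition mu → mu ⊆ₚ la →
    (T : Cell → ℕ) → IsSYT la mu T →
    ((T₀ T₀' : Cell → ℕ) → IsSYT mu [] T₀ → IsSYT mu [] T₀' →
       sign mu T₀ * sign la (T₀ ⋄⟨ mu ⟩ T) ≡ sign mu T₀' * sign la (T₀' ⋄⟨ mu ⟩ T))
    × ((T₀ : Cell → ℕ) → IsSYT mu [] T₀ →
       sign mu T₀ * sign la (T₀ ⋄⟨ mu ⟩ T) ≡ sgnPow (mExp la mu) * sgnPow (inv la mu T))
proposition4p1 la mu _ pmu sub T syt = independent , formula
  where
  open ≡-Reasoning
  formula : (T₀ : Cell → ℕ) → IsSYT mu [] T₀ →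
            sign mu T₀ * sign la (T₀ ⋄⟨ mu ⟩ T) ≡ sgnPow (mExp la mu) * sgnPow (inv la mu T)
  formula T₀ syt₀ = begin
    sgnPow (inv mu [] T₀) * sgnPow (inv la [] (T₀ ⋄⟨ mu ⟩ T))
      ≡⟨ cong (λ n → sgnPow (inv mu [] T₀) * sgnPow n) (inv-concatenation la mu pmu sub T₀ T syt₀ syt) ⟩
    sgnPow (inv mu [] T₀) * sgnPow (inv mu [] T₀ + (crossings la mu + inv la mu T))
      ≡⟨ sgnPow-cancel (inv mu [] T₀) (crossings la mu) (inv la mu T) ⟩
    sgnPow (crossings la mu) * sgnPow (inv la mu T)
      ≡⟨ cong (λ n → sgnPow n * sgnPow (inv la mu T)) (crossings≡mExp la mu pmu sub) ⟩
    sgnPow (mExp la mu) * sgnPow (inv la mu T) ∎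

  independent : (T₀ T₀' : Cell → ℕ) → IsSYT mu [] T₀ → IsSYT mu [] T₀' →
                sign mu T₀ * sign la (T₀ ⋄⟨ mu ⟩ T) ≡ sign mu T₀' * sign la (T₀' ⋄⟨ mu ⟩ T)
  independent T₀ T₀' syt₀ syt₀' = trans (formula T₀ syt₀) (sym (formula T₀' syt₀'))
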